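{- Every (finite, simple) graph $G$ with minimum degree at least $3$ has a dominating $K_4$-model.
   Context: A dominating $K_t$-model in a graph $G$ is a sequence $(T_1,\dots,T_t)$ of pairwise disjoint non-empty connected subgraphs of $G$ such that for all $1\le i<j\le t$, every vertex of $T_j$ has a neighbour in $T_i$. -}

module Defs where

open import Data.Nat using (ℕ; _≥_)
open import Data.Fin using (Fin)
open import Data.Bool using (Bool; true; false; T)
open import Data.List using (List; []; _∷_; length; filter)
open import Data.Product using (Σ; _×_; ∃; ∃-syntax)
open import Relation.Binary.PropositionalEquality using (_≡_; _≢_)
open import Relation.Nullary using (¬_)
open import Relation.Nullary.Decidable using (does)
import Data.List as L

record Graph (n : ℕ) : Set where
  field
    adj   : Fin n → Fin n → Bool
    sym   : ∀ u v → adj u v ≡ adj v u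
    irrefl : ∀ v → adj v v ≡ false
open Graph public

Adj : ∀ {n} → Graph n → Fin n → Fin n → Set
Adj G u v = T (adj G u v)

degree : ∀ {n} → Graph n → Fin n → ℕ
degree {n} G v = length (filter (λ u → Data.Bool._≟_ (adj G v u) true) (L.allFin n))

minDegree≥ : ∀ {n} → Graph n → ℕ → Set
minDegree≥ {n} G k = (v : Fin n) → degree G v ≥ k

VSet : ℕ → Set
VSet n = Fin n → Bool

_∈ₛ_ : ∀ {n} → Fin n → VSet n → Set
v ∈ₛ S = T (S v)

data Walk {n} (G : Graph n) (S : VSet n) : Fin n → Fin n → Set where
  here : ∀ {u} → u ∈ₛ S → Walk G S u u
  step : ∀ {u w v} → u ∈ₛ S → Adj G u w → Walk G S w v → Walk G S u v

NonEmptyConnected : ∀ {n} → Graph n → VSet n → Set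
NonEmptyConnected {n} G S =
  (∃[ v ] v ∈ₛ S) × ((u v : Fin n) → u ∈ₛ S → v ∈ₛ S → Walk G S u v)

Disjoint : ∀ {n} → VSet n → VSet n → Set
Disjoint {n} S R = (v : Fin n) → v ∈ₛ S → v ∈ₛ R → Data.Empty.⊥
  where import Data.Empty

Dominates : ∀ {n} → Graph n → VSet n → VSet n → Set
Dominates {n} G S R = (v : Fin n) → v ∈ₛ R → ∃[ u ] (u ∈ₛ S × Adj G v u)

record DominatingModel {n} (G : Graph n) (t : ℕ) : Set where
  field
    branch    : Fin t → VSet n
    connected : (i : Fin t) → NonEmptyConnected G (branch i)
    disjoint  : (i j : Fin t) → i ≢ j → Disjoint (branch i) (branch j)
    dominating : (i j : Fin t) → i Data.Fin.< j → Dominates G (branch i) (branch j)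

{-# OPTIONS --safe #-}
module Submission where

-- We grow a connected vertex set S, keeping a cycle C of G - S that is reachable from S.
-- Once every vertex of C has a neighbour in S, consecutive vertices c₀ c₁ of C give the
-- dominating K₄-model S, C - c₀ - c₁, {c₁}, {c₀}. Otherwise some r ∈ C has no neighbour in S,
-- and we add a boundary vertex b of S (outside S, with a neighbour in S) together with a new
-- cycle of G - S - b:
--  * if some boundary vertex lies off C, we add it and keep C;
--  * if b is the only boundary vertex, every vertex of G - S - b still has degree at least 2
--    there, so a non-backtracking walk starting next to b closes a cycle;
--  * otherwise two boundary vertices lie on C. A non-backtracking walk from a third neighbour of
--    r either closes a cycle off C, or returns to C at some y, forming an ear from r to y. The
--    ear and one of the two arcs of C between r and y form a cycle that misses a boundary
--    vertex other than y.
-- Since S grows strictly, the process ends.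

open import Data.Bool using (true; T)
import Data.Bool as Bool
open import Data.Bool.Properties using (T-≡; T?)
open import Data.Empty using (⊥; ⊥-elim)
open import Data.Fin using (Fin; zero; suc; _≟_)
import Data.Fin as Fin
open import Data.Fin.Properties using (<-cmp)
import Data.Fin.Properties as Fin
open import Data.Fin.Subset using (Subset; _⊃_) renaming (_∈_ to _∈ₚ_)
open import Data.Fin.Subset.Induction using (⊃-wellFounded)
open import Data.List
  using (List; []; _∷_; _++_; [_]; _∷ʳ_; _∷ʳ′_; reverse; reverseAcc; length; initLast; allFin)
open import Data.List.Properties
  using ( ++-assoc; ++-identityʳ; unfold-reverse; reverse-++; length-reverse; reverse-involutive
        ; ∷-injectiveˡ; ∷ʳ-injectiveʳ)
open import Data.List.Membership.Propositional using (_∈_; _∉_; find; lose)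
open import Data.List.Membership.Propositional.Properties using (∈-∃++; ∈-++⁻; ∈-++⁺ˡ; ∈-++⁺ʳ)
open import Data.List.Relation.Binary.Disjoint.Propositional renaming (Disjoint to Disjointₗ)
open import Data.List.Relation.Binary.Permutation.Propositional using (_↭_; ↭-trans; ↭-prep; ↭-sym; ↭⇒↭ₛ)
open import Data.List.Relation.Binary.Permutation.Propositional.Properties
  using (shift; ++-comm; ↭-length; ↭-reverse; ∈-resp-↭)
import Data.List.Relation.Binary.Permutation.Setoid.Properties as ↭ₛ
open import Data.List.Relation.Binary.Subset.Propositional using (_⊆_)
open import Data.List.Relation.Binary.Subset.Propositional.Properties using (xs⊆xs++ys; ⊆-reflexive-↭)
open import Data.List.Relation.Unary.All using (All; []; _∷_)
import Data.List.Relation.Unary.All as All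
import Data.List.Relation.Unary.All.Properties as All
open import Data.List.Relation.Unary.AllPairs using ([]; _∷_)
import Data.List.Relation.Unary.AllPairs as AllPairs
open import Data.List.Relation.Unary.Any using (Any; here; there)
import Data.List.Relation.Unary.Any as Any
import Data.List.Relation.Unary.Any.Properties as Any
open import Data.List.Relation.Unary.Linked using (Linked; []; [-]; _∷_)
import Data.List.Relation.Unary.Linked as Linked
open import Data.List.Relation.Unary.Unique.Propositional using (Unique)
import Data.List.Relation.Unary.Unique.Propositional.Properties as Unique
open import Data.Nat using (ℕ; suc; _≤_; z≤n; s≤s)
open import Data.Nat.Properties using (≤-trans)
open import Data.Product using (_×_; _,_; map₁; map₂; proj₁; proj₂; ∃)
open import Data.Sum using (_⊎_; inj₁; inj₂; [_,_]′)
open import Data.Unit using (⊤; tt)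
open import Data.Vec using (tabulate)
open import Data.Vec.Properties using (lookup∘tabulate; lookup⇒[]=; []=⇒lookup)
open import Function using (_∘_; id; Equivalence)
open import Induction.WellFounded using (WellFounded; Acc; acc)
open import Level using (0ℓ)
open import Relation.Binary using (Rel; Symmetric; tri<; tri≈; tri>)
import Relation.Binary.Construct.On as On
open import Relation.Binary.PropositionalEquality using (_≡_; _≢_; refl; sym; trans; cong; subst; setoid)
open import Relation.Binary.PropositionalEquality.Properties using (module ≡-Reasoning)
open import Relation.Nullary.Decidable
  using (Dec; yes; no; ¬?; _×-dec_; isYes; toWitness; fromWitness; decidable-stable)
open import Relation.Nullary.Negation using (¬_; contradiction)

open import Defs hiding (sym)

module _ {a} {A : Set a} where

  ∉-∷⁺ : ∀ {v x : A} {xs} → v ≢ x → v ∉ xs → v ∉ x ∷ xs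
  ∉-∷⁺ v≢x _    (here v≡x)   = v≢x v≡x
  ∉-∷⁺ _   v∉xs (there v∈xs) = v∉xs v∈xs

  Unique-++⁻ˡ : ∀ xs {ys : List A} → Unique (xs ++ ys) → Unique xs
  Unique-++⁻ˡ []       _             = []
  Unique-++⁻ˡ (x ∷ xs) (x∉ ∷ unique) = All.++⁻ˡ xs x∉ ∷ Unique-++⁻ˡ xs unique

  Unique-++⇒Disjoint : ∀ xs {ys : List A} → Unique (xs ++ ys) → Disjointₗ xs ys
  Unique-++⇒Disjoint (x ∷ xs) (x∉ ∷ _)      (here refl  , v∈ys) = All.lookup (All.++⁻ʳ xs x∉) v∈ys refl
  Unique-++⇒Disjoint (x ∷ xs) (_  ∷ unique) (there v∈xs , v∈ys) = Unique-++⇒Disjoint xs unique (v∈xs , v∈ys)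

  Unique-resp-↭ : ∀ {xs ys : List A} → xs ↭ ys → Unique xs → Unique ys
  Unique-resp-↭ xs↭ys = ↭ₛ.Unique-resp-↭ (setoid A) (↭⇒↭ₛ xs↭ys)

  Unique⇒length≤2 : ∀ {p q} {xs : List A} → Unique xs → All (λ x → x ≡ p ⊎ x ≡ q) xs → length xs ≤ 2
  Unique⇒length≤2 {xs = []}              _ _ = z≤n
  Unique⇒length≤2 {xs = _ ∷ []}          _ _ = s≤s z≤n
  Unique⇒length≤2 {xs = _ ∷ _ ∷ []}      _ _ = s≤s (s≤s z≤n)
  Unique⇒length≤2 {p} {q} {a ∷ b ∷ c ∷ _} ((a≢b ∷ a≢c ∷ _) ∷ (b≢c ∷ _) ∷ _) (a∈ ∷ b∈ ∷ c∈ ∷ _) =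
    ⊥-elim (pigeonhole a∈ b∈ c∈)
    where
    pigeonhole : a ≡ p ⊎ a ≡ q → b ≡ p ⊎ b ≡ q → c ≡ p ⊎ c ≡ q → ⊥
    pigeonhole (inj₁ refl) (inj₁ refl) _           = a≢b refl
    pigeonhole (inj₂ refl) (inj₂ refl) _           = a≢b refl
    pigeonhole (inj₁ refl) (inj₂ refl) (inj₁ refl) = a≢c refl
    pigeonhole (inj₁ refl) (inj₂ refl) (inj₂ refl) = b≢c refl
    pigeonhole (inj₂ refl) (inj₁ refl) (inj₁ refl) = b≢c refl
    pigeonhole (inj₂ refl) (inj₁ refl) (inj₂ refl) = a≢c refl

  1≤length-++-∷ : ∀ xs {y} {ys : List A} → 1 ≤ length (xs ++ y ∷ ys)
  1≤length-++-∷ []      = s≤s z≤n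
  1≤length-++-∷ (_ ∷ _) = s≤s z≤n

  3≤length-∷-++-∷ : ∀ {x} xs {y} {ys : List A} → xs ≢ [] ⊎ ys ≢ [] → 3 ≤ length (x ∷ xs ++ y ∷ ys)
  3≤length-∷-++-∷ (_ ∷ xs)        _            = s≤s (s≤s (1≤length-++-∷ xs))
  3≤length-∷-++-∷ []              (inj₁ []≢[]) = ⊥-elim ([]≢[] refl)
  3≤length-∷-++-∷ [] {ys = []}    (inj₂ []≢[]) = ⊥-elim ([]≢[] refl)
  3≤length-∷-++-∷ [] {ys = _ ∷ _} (inj₂ _)     = s≤s (s≤s (s≤s z≤n))

  reverse-≢[] : ∀ {xs : List A} → xs ≢ [] → reverse xs ≢ []
  reverse-≢[] {xs} xs≢[] rev≡[] = xs≢[] (trans (sym (reverse-involutive xs)) (cong reverse rev≡[]))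

  reverse-++-∷ : ∀ xs {y} (ys : List A) → reverse (xs ++ y ∷ ys) ≡ reverse ys ++ y ∷ reverse xs
  reverse-++-∷ xs {y} ys = begin
    reverse (xs ++ y ∷ ys)          ≡⟨ reverse-++ xs (y ∷ ys) ⟩
    reverse (y ∷ ys) ++ reverse xs  ≡⟨ cong (_++ reverse xs) (unfold-reverse y ys) ⟩
    (reverse ys ∷ʳ y) ++ reverse xs ≡⟨ ++-assoc (reverse ys) [ y ] (reverse xs) ⟩
    reverse ys ++ y ∷ reverse xs    ∎
    where open ≡-Reasoning

  ∷-reverse-++-∷-⊆ : ∀ {x y} xs (ys : List A) → x ∷ reverse ys ++ y ∷ reverse xs ⊆ x ∷ xs ++ y ∷ ys
  ∷-reverse-++-∷-⊆ xs ys (here refl) = here refl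
  ∷-reverse-++-∷-⊆ xs ys (there v∈)  =
    there (Any.reverse⁻ (subst (_ ∈_) (sym (reverse-++-∷ xs ys)) v∈))

module _ {a ℓ} {A : Set a} {R : Rel A ℓ} where

  Linked-++⁻ˡ : ∀ xs {ys} → Linked R (xs ++ ys) → Linked R xs
  Linked-++⁻ˡ []            _       = []
  Linked-++⁻ˡ (x ∷ [])      _       = [-]
  Linked-++⁻ˡ (x ∷ x′ ∷ xs) (r ∷ l) = r ∷ Linked-++⁻ˡ (x′ ∷ xs) l

  Linked-split : ∀ xs {y ys} → Linked R (xs ++ y ∷ ys) → Linked R (xs ∷ʳ y) × Linked R (y ∷ ys)
  Linked-split []            l       = [-] , l
  Linked-split (x ∷ [])      (r ∷ l) = r ∷ [-] , l
  Linked-split (x ∷ x′ ∷ xs) (r ∷ l) = map₁ (r ∷_) (Linked-split (x′ ∷ xs) l)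

  Linked-join : ∀ xs {y ys} → Linked R (xs ∷ʳ y) → Linked R (y ∷ ys) → Linked R (xs ++ y ∷ ys)
  Linked-join []            _         l = l
  Linked-join (x ∷ [])      (r ∷ [-]) l = r ∷ l
  Linked-join (x ∷ x′ ∷ xs) (r ∷ l′)  l = r ∷ Linked-join (x′ ∷ xs) l′ l

  Linked-∷ʳ⇒Any : ∀ x xs {y} → Linked R (x ∷ xs ∷ʳ y) → Any (λ z → R z y) (x ∷ xs)
  Linked-∷ʳ⇒Any x []        (r ∷ [-]) = here r
  Linked-∷ʳ⇒Any x (x′ ∷ xs) (_ ∷ l)   = there (Linked-∷ʳ⇒Any x′ xs l)

  Linked-reverse : Symmetric R → ∀ {xs} → Linked R xs → Linked R (reverse xs)
  Linked-reverse sym {[]}    []  = []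
  Linked-reverse sym {_ ∷ _} l   = go l [-]
    where
    go : ∀ {x xs acc} → Linked R (x ∷ xs) → Linked R (x ∷ acc) → Linked R (reverseAcc (x ∷ acc) xs)
    go [-]     l′ = l′
    go (r ∷ l) l′ = go l (sym r ∷ l′)

-- Vertex sets as lists

module _ {n : ℕ} where

  open import Data.List.Membership.DecPropositional (_≟_ {n}) using (_∈?_)

  ⟦_⟧ : List (Fin n) → VSet n
  ⟦ xs ⟧ v = isYes (v ∈? xs)

  ∈⟦⟧⁺ : ∀ {v xs} → v ∈ xs → v ∈ₛ ⟦ xs ⟧
  ∈⟦⟧⁺ = fromWitness

  ∈⟦⟧⁻ : ∀ {v xs} → v ∈ₛ ⟦ xs ⟧ → v ∈ xs
  ∈⟦⟧⁻ = toWitness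

  toSubset : List (Fin n) → Subset n
  toSubset xs = tabulate ⟦ xs ⟧

  ∈-toSubset⁺ : ∀ {v xs} → v ∈ xs → v ∈ₚ toSubset xs
  ∈-toSubset⁺ {v} {xs} v∈xs =
    lookup⇒[]= v (toSubset xs) (trans (lookup∘tabulate ⟦ xs ⟧ v) (Equivalence.to T-≡ (∈⟦⟧⁺ v∈xs)))

  ∈-toSubset⁻ : ∀ {v xs} → v ∈ₚ toSubset xs → v ∈ xs
  ∈-toSubset⁻ {v} {xs} v∈p =
    ∈⟦⟧⁻ (Equivalence.from T-≡ (trans (sym (lookup∘tabulate ⟦ xs ⟧ v)) ([]=⇒lookup v∈p)))

  infix 4 _⊐_
  _⊐_ : Rel (List (Fin n)) 0ℓ
  xs ⊐ ys = toSubset xs ⊃ toSubset ys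

  ⊐-wellFounded : WellFounded _⊐_
  ⊐-wellFounded = On.wellFounded toSubset ⊃-wellFounded

  ∷-⊐ : ∀ {x xs} → x ∉ xs → x ∷ xs ⊐ xs
  ∷-⊐ {x} x∉xs =
    ∈-toSubset⁺ ∘ there ∘ ∈-toSubset⁻ , x , ∈-toSubset⁺ (here refl) , x∉xs ∘ ∈-toSubset⁻

module _ {n : ℕ} (G : Graph n) where

  open import Data.List.Membership.DecPropositional (_≟_ {n}) using (_∈?_)

  private
    variable
      u v w x y r : Fin n
      A B : VSet n
      xs ys K L : List (Fin n)

  Adj-sym : Adj G u v → Adj G v u
  Adj-sym {u} {v} = subst T (Graph.sym G u v)

  Adj⇒≢ : Adj G u v → u ≢ v
  Adj⇒≢ {u} u~u refl = subst T (irrefl G u) u~u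

  -- Walks

  full : VSet n
  full _ = true

  Walk-mono : (∀ {w} → w ∈ₛ A → w ∈ₛ B) → Walk G A u v → Walk G B u v
  Walk-mono A⊆B (here u∈A)          = here (A⊆B u∈A)
  Walk-mono A⊆B (step u∈A u~w walk) = step (A⊆B u∈A) u~w (Walk-mono A⊆B walk)

  Walk-start : Walk G A u v → u ∈ₛ A
  Walk-start (here u∈A)     = u∈A
  Walk-start (step u∈A _ _) = u∈A

  infixr 5 _◅◅_
  _◅◅_ : Walk G A u v → Walk G A v w → Walk G A u w
  here _            ◅◅ walk′ = walk′
  step u∈A u~w walk ◅◅ walk′ = step u∈A u~w (walk ◅◅ walk′)

  Walk-reverse : Walk G A u v → Walk G A v u
  Walk-reverse (here u∈A)          = here u∈A
  Walk-reverse (step u∈A u~w walk) = Walk-reverse walk ◅◅ step (Walk-start walk) (Adj-sym u~w) (here u∈A)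

  walk-from-head : (∀ {v} → v ∈ x ∷ xs → v ∈ₛ A) → Linked (Adj G) (x ∷ xs) → y ∈ x ∷ xs → Walk G A x y
  walk-from-head ⊆A _          (here refl) = here (⊆A (here refl))
  walk-from-head ⊆A (x~x′ ∷ l) (there y∈)  =
    step (⊆A (here refl)) x~x′ (walk-from-head (⊆A ∘ there) l y∈)

  Linked-walk : (∀ {v} → v ∈ xs → v ∈ₛ A) → Linked (Adj G) xs → x ∈ xs → y ∈ xs → Walk G A x y
  Linked-walk {xs = _ ∷ _} ⊆A l x∈ y∈ =
    Walk-reverse (walk-from-head ⊆A l x∈) ◅◅ walk-from-head ⊆A l y∈

  Linked⇒NonEmptyConnected : Linked (Adj G) (x ∷ xs) → NonEmptyConnected G ⟦ x ∷ xs ⟧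
  Linked⇒NonEmptyConnected {x} l =
    (x , ∈⟦⟧⁺ (here refl)) , λ u v u∈ v∈ → Linked-walk ∈⟦⟧⁺ l (∈⟦⟧⁻ u∈) (∈⟦⟧⁻ v∈)

  NonEmptyConnected-∷ : ∀ {S} → NonEmptyConnected G ⟦ S ⟧ → Any (Adj G x) S →
                        NonEmptyConnected G ⟦ x ∷ S ⟧
  NonEmptyConnected-∷ {x} {S} (_ , walk) x→S = (x , ∈⟦⟧⁺ (here refl)) , walk′
    where
    widen : Walk G ⟦ S ⟧ u v → Walk G ⟦ x ∷ S ⟧ u v
    widen = Walk-mono (∈⟦⟧⁺ ∘ there ∘ ∈⟦⟧⁻)
    from-x : v ∈ S → Walk G ⟦ x ∷ S ⟧ x v
    from-x v∈S with find x→S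
    ... | s , s∈S , x~s = step (∈⟦⟧⁺ (here refl)) x~s (widen (walk s _ (∈⟦⟧⁺ s∈S) (∈⟦⟧⁺ v∈S)))
    walk′ : ∀ u v → u ∈ₛ ⟦ x ∷ S ⟧ → v ∈ₛ ⟦ x ∷ S ⟧ → Walk G ⟦ x ∷ S ⟧ u v
    walk′ u v u∈ v∈ with ∈⟦⟧⁻ u∈ | ∈⟦⟧⁻ v∈
    ... | here refl | here refl = here u∈
    ... | here refl | there v∈S = from-x v∈S
    ... | there u∈S | here refl = Walk-reverse (from-x u∈S)
    ... | there u∈S | there v∈S = widen (walk u v (∈⟦⟧⁺ u∈S) (∈⟦⟧⁺ v∈S))

  -- Cycles

  Closed : List (Fin n) → Set
  Closed []       = ⊤
  Closed (c ∷ cs) = Linked (Adj G) (c ∷ cs ∷ʳ c)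

  record Cycle (K : List (Fin n)) : Set where
    field
      long   : 3 ≤ length K
      unique : Unique K
      closed : Closed K

  Cycle-linked : Cycle K → Linked (Adj G) K
  Cycle-linked {[]}     _ = []
  Cycle-linked {c ∷ cs} C = Linked-++⁻ˡ (c ∷ cs) (Cycle.closed C)

  Cycle-walk : Cycle K → x ∈ K → y ∈ K → Walk G full x y
  Cycle-walk C = Linked-walk (λ _ → tt) (Cycle-linked C)

  Closed-rotate : ∀ P Q → Closed (P ++ r ∷ Q) → Closed (r ∷ Q ++ P)
  Closed-rotate {r} []      Q closed = subst (λ xs → Closed (r ∷ xs)) (sym (++-identityʳ Q)) closed
  Closed-rotate {r} (p ∷ P) Q closed
    with Linked-split (p ∷ P) (subst (λ xs → Linked (Adj G) (p ∷ xs)) (++-assoc P (r ∷ Q) [ p ]) closed)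
  ... | p⋯r , r⋯p =
    subst (λ xs → Linked (Adj G) (r ∷ xs)) (sym (++-assoc Q (p ∷ P) [ r ])) (Linked-join (r ∷ Q) r⋯p p⋯r)

  Cycle-rotate : Cycle K → r ∈ K → ∃ λ L → Cycle (r ∷ L) × K ↭ r ∷ L
  Cycle-rotate {r = r} C r∈K with ∈-∃++ r∈K
  ... | P , Q , refl = Q ++ P , rotated , P++r∷Q↭r∷Q++P
    where
    P++r∷Q↭r∷Q++P : P ++ r ∷ Q ↭ r ∷ Q ++ P
    P++r∷Q↭r∷Q++P = ↭-trans (shift r P Q) (↭-prep r (++-comm P Q))
    rotated : Cycle (r ∷ Q ++ P)
    rotated = record
      { long   = subst (3 ≤_) (↭-length P++r∷Q↭r∷Q++P) (Cycle.long C)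
      ; unique = Unique-resp-↭ P++r∷Q↭r∷Q++P (Cycle.unique C)
      ; closed = Closed-rotate P Q (Cycle.closed C)
      }

  Cycle-neighbour : Cycle K → x ∈ K → ∃ λ y → y ∈ K × Adj G x y
  Cycle-neighbour C x∈K with Cycle-rotate C x∈K
  ... | []    , record { long = s≤s () } , _
  ... | a ∷ _ , C′ , K↭ = a , ∈-resp-↭ (↭-sym K↭) (there (here refl)) , Linked.head (Cycle.closed C′)

  Cycle-ends : Cycle (r ∷ L) → ∃ λ a → ∃ λ M → ∃ λ c → L ≡ a ∷ M ∷ʳ c
  Cycle-ends {L = []}     record { long = s≤s () }
  Cycle-ends {L = a ∷ L′} C with initLast L′
  ... | []      = contradiction (Cycle.long C) λ { (s≤s (s≤s ())) }
  ... | M ∷ʳ′ c = a , M , c , refl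

  Cycle-reverse : Cycle (r ∷ L) → Cycle (r ∷ reverse L)
  Cycle-reverse {r} {L} C = record
    { long   = subst (λ k → 3 ≤ suc k) (sym (length-reverse L)) (Cycle.long C)
    ; unique = Unique-resp-↭ (↭-prep r (↭-sym (↭-reverse L))) (Cycle.unique C)
    ; closed = subst (Linked (Adj G)) reverse-closed (Linked-reverse Adj-sym (Cycle.closed C))
    }
    where
    open ≡-Reasoning
    reverse-closed : reverse (r ∷ L ∷ʳ r) ≡ r ∷ reverse L ∷ʳ r
    reverse-closed = begin
      reverse (r ∷ L ∷ʳ r)  ≡⟨ unfold-reverse r (L ∷ʳ r) ⟩
      reverse (L ∷ʳ r) ∷ʳ r ≡⟨ cong (_∷ʳ r) (reverse-++ L [ r ]) ⟩
      r ∷ reverse L ∷ʳ r    ∎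

  Cycle-close : ∀ {c p rs} → Linked (Adj G) (c ∷ p ∷ rs) → Unique (c ∷ p ∷ rs) → Adj G c u → u ∈ rs →
                ∃ λ K → Cycle (c ∷ K) × c ∷ K ⊆ c ∷ p ∷ rs
  Cycle-close {u} {c} {p} l uniq c~u u∈rs with ∈-∃++ u∈rs
  ... | R₁ , R₂ , refl =
    p ∷ R₁ ∷ʳ u , cycle , subst (c ∷ p ∷ R₁ ∷ʳ u ⊆_) (sym path≡) (xs⊆xs++ys _ R₂)
    where
    path≡ : c ∷ p ∷ R₁ ++ u ∷ R₂ ≡ (c ∷ p ∷ R₁ ∷ʳ u) ++ R₂
    path≡ = cong (λ xs → c ∷ p ∷ xs) (sym (++-assoc R₁ [ u ] R₂))
    cycle : Cycle (c ∷ p ∷ R₁ ∷ʳ u)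
    cycle = record
      { long   = s≤s (s≤s (1≤length-++-∷ R₁))
      ; unique = Unique-++⁻ˡ (c ∷ p ∷ R₁ ∷ʳ u) (subst Unique path≡ uniq)
      ; closed = subst (λ xs → Linked (Adj G) (c ∷ p ∷ xs)) (sym (++-assoc R₁ [ u ] [ c ]))
                   (Linked-join (c ∷ p ∷ R₁) (proj₁ (Linked-split (c ∷ p ∷ R₁) l)) (Adj-sym c~u ∷ [-]))
      }

  -- An ear of the cycle r ∷ L₁ ++ y ∷ L₂, from y back to r; without inner vertices it must be a chord.
  record Ear (r : Fin n) (L₁ : List (Fin n)) (y : Fin n) (L₂ : List (Fin n)) : Set where
    field
      inner    : List (Fin n)
      linked   : Linked (Adj G) (y ∷ inner ∷ʳ r)
      unique   : Unique inner
      disjoint : Disjointₗ (r ∷ L₁ ++ y ∷ L₂) inner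
      proper   : inner ≡ [] → L₁ ≢ [] × L₂ ≢ []

  module _ {r L₁ y L₂} (E : Ear r L₁ y L₂) where
    open Ear E

    private
      arc≡ : ∀ zs → r ∷ L₁ ++ y ∷ zs ≡ (r ∷ L₁ ∷ʳ y) ++ zs
      arc≡ zs = cong (r ∷_) (sym (++-assoc L₁ [ y ] zs))

      arc⊆ : r ∷ L₁ ∷ʳ y ⊆ r ∷ L₁ ++ y ∷ L₂
      arc⊆ = subst (r ∷ L₁ ∷ʳ y ⊆_) (sym (arc≡ L₂)) (xs⊆xs++ys _ L₂)

      closing≡ : ∀ zs → r ∷ (L₁ ++ y ∷ zs) ∷ʳ r ≡ (r ∷ L₁) ++ y ∷ zs ∷ʳ r
      closing≡ zs = cong (r ∷_) (++-assoc L₁ (y ∷ zs) [ r ])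

    Cycle-ear : Cycle (r ∷ L₁ ++ y ∷ L₂) → Cycle (r ∷ L₁ ++ y ∷ inner)
    Cycle-ear C = record
      { long   = 3≤length-∷-++-∷ {x = r} L₁ long
      ; unique = subst Unique (sym (arc≡ inner))
                   (Unique.++⁺ (Unique-++⁻ˡ (r ∷ L₁ ∷ʳ y) (subst Unique (arc≡ L₂) (Cycle.unique C)))
                               unique (λ (v∈arc , v∈inner) → disjoint (arc⊆ v∈arc , v∈inner)))
      ; closed = subst (Linked (Adj G)) (sym (closing≡ inner)) (Linked-join (r ∷ L₁) r⋯y linked)
      }
      where
      long : L₁ ≢ [] ⊎ inner ≢ []
      long with inner in eq
      ... | []    = inj₁ (proj₁ (proper eq))
      ... | _ ∷ _ = inj₂ λ ()
      r⋯y : Linked (Adj G) (r ∷ L₁ ∷ʳ y)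
      r⋯y = proj₁ (Linked-split (r ∷ L₁) (subst (Linked (Adj G)) (closing≡ L₂) (Cycle.closed C)))

    ear-cycle-avoids : Unique (r ∷ L₁ ++ y ∷ L₂) → v ∈ L₂ → v ∉ r ∷ L₁ ++ y ∷ inner
    ear-cycle-avoids {v} uniq v∈L₂ v∈ear with ∈-++⁻ (r ∷ L₁ ∷ʳ y) (subst (v ∈_) (arc≡ inner) v∈ear)
    ... | inj₁ v∈arc   = Unique-++⇒Disjoint (r ∷ L₁ ∷ʳ y) (subst Unique (arc≡ L₂) uniq) (v∈arc , v∈L₂)
    ... | inj₂ v∈inner = disjoint (∈-++⁺ʳ (r ∷ L₁) (there v∈L₂) , v∈inner)

    ear-cycle-⊆ : r ∷ L₁ ++ y ∷ inner ⊆ (r ∷ L₁ ++ y ∷ L₂) ++ inner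
    ear-cycle-⊆ {v} v∈ear with ∈-++⁻ (r ∷ L₁ ∷ʳ y) (subst (v ∈_) (arc≡ inner) v∈ear)
    ... | inj₁ v∈arc   = ∈-++⁺ˡ (arc⊆ v∈arc)
    ... | inj₂ v∈inner = ∈-++⁺ʳ _ v∈inner

  Ear-reverse : ∀ {L₁ L₂} → Ear r L₁ y L₂ → Ear r (reverse L₂) y (reverse L₁)
  Ear-reverse {L₁ = L₁} {L₂} E = record
    { inner    = inner
    ; linked   = linked
    ; unique   = unique
    ; disjoint = λ (v∈ , v∈inner) → disjoint (∷-reverse-++-∷-⊆ L₁ L₂ v∈ , v∈inner)
    ; proper   = λ inner≡[] → let L₁≢[] , L₂≢[] = proper inner≡[] in reverse-≢[] L₂≢[] , reverse-≢[] L₁≢[]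
    }
    where open Ear E

  -- Non-backtracking walks

  record ReachableCycle (X : Fin n → Set) (x : Fin n) : Set where
    field
      cycle   : List (Fin n)
      isCycle : Cycle cycle
      inside  : All X cycle
      target  : Fin n
      target∈ : target ∈ cycle
      walk    : Walk G full x target

  ReachableCycle-map : ∀ {X Y} (C : ReachableCycle X x) →
                       (∀ {v} → v ∈ ReachableCycle.cycle C → X v → Y v) → ReachableCycle Y x
  ReachableCycle-map C X⇒Y =
    record { ReachableCycle C hiding (inside)
           ; inside = All.tabulate λ v∈ → X⇒Y v∈ (All.lookup inside v∈) }
    where open ReachableCycle C using (inside)

  infixr 5 _◅ᶜ_
  _◅ᶜ_ : ∀ {X} → Walk G full y x → ReachableCycle X x → ReachableCycle X y
  walk ◅ᶜ C = record { ReachableCycle C hiding (walk) ; walk = walk ◅◅ ReachableCycle.walk C }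

  -- A non-backtracking walk through X, entered from p₀, has reached end ∈ Y; path lists it latest vertex first.
  record Arrival (X Y : Fin n → Set) (p₀ : Fin n) : Set where
    field
      end             : Fin n
      end∈Y           : Y end
      path            : List (Fin n)
      linked          : Linked (Adj G) (end ∷ path ∷ʳ p₀)
      inside          : All X path
      unique          : Unique path
      nonempty        : path ≢ []
      nonbacktracking : end ≡ p₀ → 2 ≤ length path

  nonbacktracking-walk : ∀ {X Y : Fin n → Set} →
                         (∀ {u} → X u → ∀ p → ∃ λ u′ → Adj G u u′ × u′ ≢ p × (Y u′ ⊎ X u′)) →
                         X x → Adj G x y → Arrival X Y y ⊎ ReachableCycle X x
  nonbacktracking-walk {x} {p₀} {X} {Y} continue x∈X x~p₀ =
    go x [] (⊐-wellFounded _) (x~p₀ ∷ [-]) (x∈X ∷ []) ([] ∷ []) (here refl)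
    where
    previous : List (Fin n) → Fin n
    previous []      = p₀
    previous (p ∷ _) = p

    revisit : ∀ {c rs} → Linked (Adj G) (c ∷ rs) → All X (c ∷ rs) → Unique (c ∷ rs) → x ∈ c ∷ rs →
              Adj G c u → u ≢ previous rs → u ∈ c ∷ rs → ReachableCycle X x
    revisit _ _ _ _ c~u _   (here refl)         = ⊥-elim (Adj⇒≢ c~u refl)
    revisit _ _ _ _ _   u≢p (there (here refl)) = ⊥-elim (u≢p refl)
    revisit {c = c} l inX uniq x∈ c~u _ (there (there u∈rs)) with Cycle-close l uniq c~u u∈rs
    ... | K , C , K⊆path = record
      { cycle = c ∷ K ; isCycle = C ; inside = All.anti-mono K⊆path inX
      ; target = c ; target∈ = here refl ; walk = Linked-walk (λ _ → tt) l x∈ (here refl) }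

    go : ∀ c rs → Acc _⊐_ (c ∷ rs) → Linked (Adj G) (c ∷ rs ∷ʳ p₀) → All X (c ∷ rs) → Unique (c ∷ rs) →
         x ∈ c ∷ rs → Arrival X Y p₀ ⊎ ReachableCycle X x
    go c rs (acc smaller) l inX uniq x∈ with continue (All.head inX) (previous rs)
    ... | u , c~u , u≢p , inj₁ u∈Y = inj₁ record
      { end = u ; end∈Y = u∈Y ; path = c ∷ rs ; linked = Adj-sym c~u ∷ l ; inside = inX ; unique = uniq
      ; nonempty = λ () ; nonbacktracking = long rs u≢p }
      where
      long : ∀ rs → u ≢ previous rs → u ≡ p₀ → 2 ≤ length (c ∷ rs)
      long []      u≢p₀ u≡p₀ = ⊥-elim (u≢p₀ u≡p₀)
      long (_ ∷ _) _    _    = s≤s (s≤s z≤n)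
    ... | u , c~u , u≢p , inj₂ u∈X with u ∈? c ∷ rs
    ...   | yes u∈path = inj₂ (revisit (Linked-++⁻ˡ (c ∷ rs) l) inX uniq x∈ c~u u≢p u∈path)
    ...   | no  u∉path = go u (c ∷ rs) (smaller (∷-⊐ u∉path)) (Adj-sym c~u ∷ l) (u∈X ∷ inX)
                           (All.¬Any⇒All¬ _ u∉path ∷ uniq) (there x∈)

  cycle-in-deg≥2 : ∀ {X : Fin n → Set} → (∀ {u} → X u → ∀ p → ∃ λ u′ → Adj G u u′ × u′ ≢ p × X u′) →
                   X x → Adj G x y → ReachableCycle X x
  cycle-in-deg≥2 continue x∈X x~y =
    [ (λ arrival → ⊥-elim (Arrival.end∈Y arrival)) , id ]′
      (nonbacktracking-walk {Y = λ _ → ⊥} (λ u∈X p → map₂ (map₂ (map₂ inj₂)) (continue u∈X p)) x∈X x~y)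

  -- Domination

  Dominated : List (Fin n) → Fin n → Set
  Dominated S v = Any (Adj G v) S

  dominated? : ∀ S v → Dec (Dominated S v)
  dominated? S v = Any.any? (λ u → T? (adj G v u)) S

  Dominates-⟦⟧ : ∀ {S} → All (Dominated S) xs → Dominates G ⟦ S ⟧ ⟦ xs ⟧
  Dominates-⟦⟧ dom v v∈xs with find (All.lookup dom (∈⟦⟧⁻ v∈xs))
  ... | s , s∈S , v~s = s , ∈⟦⟧⁺ s∈S , v~s

  Disjoint-⟦⟧ : Disjointₗ xs ys → Disjoint ⟦ xs ⟧ ⟦ ys ⟧
  Disjoint-⟦⟧ xs#ys v v∈xs v∈ys = xs#ys (∈⟦⟧⁻ v∈xs , ∈⟦⟧⁻ v∈ys)

  pairs-of-four : ∀ {P : Fin 4 → Fin 4 → Set} →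
    P zero (suc zero) → P zero (suc (suc zero)) → P zero (suc (suc (suc zero))) →
    P (suc zero) (suc (suc zero)) → P (suc zero) (suc (suc (suc zero))) →
    P (suc (suc zero)) (suc (suc (suc zero))) →
    ∀ i j → i Fin.< j → P i j
  pairs-of-four p01 _   _   _   _   _   zero                   (suc zero)             _ = p01
  pairs-of-four _   p02 _   _   _   _   zero                   (suc (suc zero))       _ = p02
  pairs-of-four _   _   p03 _   _   _   zero                   (suc (suc (suc zero))) _ = p03
  pairs-of-four _   _   _   p12 _   _   (suc zero)             (suc (suc zero))       _ = p12
  pairs-of-four _   _   _   _   p13 _   (suc zero)             (suc (suc (suc zero))) _ = p13
  pairs-of-four _   _   _   _   _   p23 (suc (suc zero))       (suc (suc (suc zero))) _ = p23
  pairs-of-four _   _   _   _   _   _   zero                   zero                   ()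
  pairs-of-four _   _   _   _   _   _   (suc _)                zero                   ()
  pairs-of-four _   _   _   _   _   _   (suc zero)             (suc zero)             (s≤s ())
  pairs-of-four _   _   _   _   _   _   (suc (suc _))          (suc zero)             (s≤s ())
  pairs-of-four _   _   _   _   _   _   (suc (suc zero))       (suc (suc zero))       (s≤s (s≤s ()))
  pairs-of-four _   _   _   _   _   _   (suc (suc (suc _)))    (suc (suc zero))       (s≤s (s≤s ()))
  pairs-of-four _   _   _   _   _   _   (suc (suc (suc zero))) (suc (suc (suc zero))) (s≤s (s≤s (s≤s ())))

  model-from-parts : ∀ {t} (part : Fin t → List (Fin n)) → (∀ i → NonEmptyConnected G ⟦ part i ⟧) →
                     (∀ i j → i Fin.< j → Disjointₗ (part i) (part j)) →
                     (∀ i j → i Fin.< j → All (Dominated (part i)) (part j)) → DominatingModel G t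
  model-from-parts part connected disjoint< dominated = record
    { branch     = λ i → ⟦ part i ⟧
    ; connected  = connected
    ; disjoint   = disjoint
    ; dominating = λ i j i<j → Dominates-⟦⟧ (dominated i j i<j)
    }
    where
    disjoint : ∀ i j → i ≢ j → Disjoint ⟦ part i ⟧ ⟦ part j ⟧
    disjoint i j i≢j with <-cmp i j
    ... | tri< i<j _ _ = Disjoint-⟦⟧ (disjoint< i j i<j)
    ... | tri≈ _ i≡j _ = ⊥-elim (i≢j i≡j)
    ... | tri> _ _ j<i = λ v v∈i v∈j → Disjoint-⟦⟧ (disjoint< j i j<i) v v∈j v∈i

  cycle-model : ∀ {S} → NonEmptyConnected G ⟦ S ⟧ → Cycle K → All (_∉ S) K → All (Dominated S) K →
                DominatingModel G 4
  cycle-model {[]}         _ record { long = () }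
  cycle-model {_ ∷ []}     _ record { long = s≤s () }
  cycle-model {_ ∷ _ ∷ []} _ record { long = s≤s (s≤s ()) }
  cycle-model {c₀ ∷ c₁ ∷ c₂ ∷ R} {S} S-connected C outside dom = model-from-parts part connected
    (pairs-of-four (S# (All.tail (All.tail outside))) (S# (All.head (All.tail outside) ∷ []))
                   (S# (All.head outside ∷ [])) #[ c₁∉ ] #[ All.tail c₀∉ ] #[ All.head c₀∉ ∷ [] ])
    (pairs-of-four (All.tail (All.tail dom)) (All.head (All.tail dom) ∷ []) (All.head dom ∷ [])
                   (lose (here refl) c₁~c₂ ∷ []) (Any.map Adj-sym R~c₀ ∷ []) (lose (here refl) c₀~c₁ ∷ []))
    where
    part : Fin 4 → List (Fin n)
    part zero                = S
    part (suc zero)          = c₂ ∷ R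
    part (suc (suc zero))    = [ c₁ ]
    part (suc (suc (suc _))) = [ c₀ ]

    connected : ∀ i → NonEmptyConnected G ⟦ part i ⟧
    connected zero                = S-connected
    connected (suc zero)          = Linked⇒NonEmptyConnected (Linked.tail (Linked.tail (Cycle-linked C)))
    connected (suc (suc zero))    = Linked⇒NonEmptyConnected [-]
    connected (suc (suc (suc _))) = Linked⇒NonEmptyConnected [-]

    c₀∉ : All (c₀ ≢_) (c₁ ∷ c₂ ∷ R)
    c₀∉ = AllPairs.head (Cycle.unique C)
    c₁∉ : All (c₁ ≢_) (c₂ ∷ R)
    c₁∉ = AllPairs.head (AllPairs.tail (Cycle.unique C))
    S# : All (_∉ S) xs → Disjointₗ S xs
    S# ∉S (v∈S , v∈xs) = All.lookup ∉S v∈xs v∈S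
    #[_] : ∀ {c} → All (c ≢_) xs → Disjointₗ xs [ c ]
    #[ c∉ ] (v∈xs , here refl) = All.lookup c∉ v∈xs refl

    closed : Linked (Adj G) (c₀ ∷ c₁ ∷ c₂ ∷ R ∷ʳ c₀)
    closed = Cycle.closed C
    c₀~c₁ : Adj G c₀ c₁
    c₀~c₁ = Linked.head closed
    c₁~c₂ : Adj G c₁ c₂
    c₁~c₂ = Linked.head (Linked.tail closed)
    R~c₀ : Any (λ v → Adj G v c₀) (c₂ ∷ R)
    R~c₀ = Linked-∷ʳ⇒Any c₂ R (Linked.tail (Linked.tail closed))

  -- Growing the first branch set

  Boundary : List (Fin n) → Fin n → Set
  Boundary S b = b ∉ S × Dominated S b

  boundary? : ∀ S b → Dec (Boundary S b)
  boundary? S b = ¬? (b ∈? S) ×-dec dominated? S b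

  walk-crosses-boundary : ∀ {S s c} → s ∈ S → c ∉ S → Walk G A s c → ∃ (Boundary S)
  walk-crosses-boundary s∈S c∉S (here _) = ⊥-elim (c∉S s∈S)
  walk-crosses-boundary {S = S} s∈S c∉S (step {w = w} _ s~w walk) with w ∈? S
  ... | yes w∈S = walk-crosses-boundary w∈S c∉S walk
  ... | no  w∉S = w , w∉S , lose s∈S (Adj-sym s~w)

  record Growth (S : List (Fin n)) : Set where
    field
      vertex   : Fin n
      boundary : Boundary S vertex
      source   : Fin n
      source∈  : source ∈ vertex ∷ S
      cycle    : ReachableCycle (_∉ vertex ∷ S) source

  grow-by : ∀ {S b} → Boundary S b → ReachableCycle (_∉ b ∷ S) b → Growth S
  grow-by bd C = record { vertex = _ ; boundary = bd ; source = _ ; source∈ = here refl ; cycle = C }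

  record EarOf (S : List (Fin n)) (r : Fin n) (L : List (Fin n)) : Set where
    field
      L₁ L₂   : List (Fin n)
      foot    : Fin n
      split   : L ≡ L₁ ++ foot ∷ L₂
      ear     : Ear r L₁ foot L₂
      outside : All (_∉ S) (Ear.inner ear)

  chord-ear : ∀ {S a M c} → Adj G r x → x ∈ a ∷ M ∷ʳ c → x ≢ a → x ≢ c → EarOf S r (a ∷ M ∷ʳ c)
  chord-ear {r} {x} {a = a} {M} {c} r~x x∈L x≢a x≢c with ∈-∃++ x∈L
  ... | L₁ , L₂ , split = record
    { L₁ = L₁ ; L₂ = L₂ ; foot = x ; split = split ; outside = []
    ; ear = record { inner = [] ; linked = Adj-sym r~x ∷ [-] ; unique = [] ; disjoint = λ { (_ , ()) }
                   ; proper = λ _ → interior split }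
    }
    where
    interior : ∀ {L₁ L₂} → a ∷ M ∷ʳ c ≡ L₁ ++ x ∷ L₂ → L₁ ≢ [] × L₂ ≢ []
    interior eq = (λ { refl → x≢a (sym (∷-injectiveˡ eq)) })
                , (λ { refl → x≢c (sym (∷ʳ-injectiveʳ (a ∷ M) _ eq)) })

  MeetsOnlyAt : List (Fin n) → List (Fin n) → Fin n → Fin n → Set
  MeetsOnlyAt S K r v = v ∉ S × (v ∈ K → v ≡ r)

  arrival⇒ear-or-cycle : ∀ {S} → r ∉ S → Arrival (λ v → v ∉ S × v ∉ r ∷ L) (_∈ r ∷ L) r →
                         EarOf S r L ⊎ ReachableCycle (MeetsOnlyAt S (r ∷ L) r) r
  arrival⇒ear-or-cycle {r} r∉S record { end∈Y = here refl ; path = path ; linked = linked ; inside = inside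
                                       ; unique = unique ; nonbacktracking = nonbacktracking } = inj₂ record
    { cycle   = r ∷ path
    ; isCycle = record { long   = s≤s (nonbacktracking refl)
                       ; unique = All.map (λ (_ , v∉C) r≡v → v∉C (here (sym r≡v))) inside ∷ unique
                       ; closed = linked }
    ; inside  = (r∉S , λ _ → refl) ∷ All.map (λ (v∉S , v∉C) → v∉S , λ v∈C → ⊥-elim (v∉C v∈C)) inside
    ; target  = r ; target∈ = here refl ; walk = here tt
    }
  arrival⇒ear-or-cycle _ record { end = y ; end∈Y = there y∈L ; path = path ; linked = linked ; inside = inside
                                ; unique = unique ; nonempty = nonempty } with ∈-∃++ y∈L
  ... | L₁ , L₂ , refl = inj₁ record
    { L₁ = L₁ ; L₂ = L₂ ; foot = y ; split = refl ; outside = All.map proj₁ inside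
    ; ear = record { inner = path ; linked = linked ; unique = unique
                   ; disjoint = λ (v∈C , v∈path) → proj₂ (All.lookup inside v∈path) v∈C
                   ; proper = ⊥-elim ∘ nonempty }
    }

  ear-cycle-beyond : ∀ {S L₁ L₂ b} → Cycle (r ∷ L₁ ++ y ∷ L₂) → All (_∉ S) (r ∷ L₁ ++ y ∷ L₂) →
                     (E : Ear r L₁ y L₂) → All (_∉ S) (Ear.inner E) → b ∈ L₂ → ReachableCycle (_∉ b ∷ S) b
  ear-cycle-beyond {r} {y} {L₁ = L₁} C outside E inner-outside b∈L₂ = record
    { cycle   = r ∷ L₁ ++ y ∷ inner
    ; isCycle = Cycle-ear E C
    ; inside  = All.tabulate λ v∈ → ∉-∷⁺ (λ { refl → ear-cycle-avoids E (Cycle.unique C) b∈L₂ v∈ })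
                                          (All.lookup (All.++⁺ outside inner-outside) (ear-cycle-⊆ E v∈))
    ; target  = y
    ; target∈ = there (∈-++⁺ʳ L₁ (here refl))
    ; walk    = Cycle-walk C (there (∈-++⁺ʳ L₁ (there b∈L₂))) (there (∈-++⁺ʳ L₁ (here refl)))
    }
    where open Ear E using (inner)

  cycle-beyond-ear : ∀ {S b} → Cycle (r ∷ L) → All (_∉ S) (r ∷ L) → (E : EarOf S r L) →
                     b ∈ L → b ≢ EarOf.foot E → ReachableCycle (_∉ b ∷ S) b
  cycle-beyond-ear {r} C outside
    record { L₁ = L₁ ; L₂ = L₂ ; split = refl ; ear = E ; outside = inner-outside } b∈L b≢y
    with ∈-++⁻ L₁ b∈L
  ... | inj₂ (here b≡y)   = ⊥-elim (b≢y b≡y)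
  ... | inj₂ (there b∈L₂) = ear-cycle-beyond C outside E inner-outside b∈L₂
  ... | inj₁ b∈L₁         =
    ear-cycle-beyond (subst (λ xs → Cycle (r ∷ xs)) (reverse-++-∷ L₁ L₂) (Cycle-reverse C))
                     (All.anti-mono (∷-reverse-++-∷-⊆ L₁ L₂) outside) (Ear-reverse E) inner-outside
                     (Any.reverse⁺ b∈L₁)

  module _ (δ≥3 : minDegree≥ G 3) where

    another-neighbour : ∀ v p q → ∃ λ u → Adj G v u × u ≢ p × u ≢ q
    another-neighbour v p q with Fin.any? (λ u → T? (adj G v u) ×-dec ¬? (u ≟ p) ×-dec ¬? (u ≟ q))
    ... | yes found = found
    ... | no  none  = contradiction (≤-trans (δ≥3 v) at-most-two) λ { (s≤s (s≤s ())) }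
      where
      adjacent? : ∀ u → Dec (adj G v u ≡ true)
      adjacent? u = adj G v u Bool.≟ true
      in-p-q : ∀ {u} → adj G v u ≡ true → u ≡ p ⊎ u ≡ q
      in-p-q {u} v~u with u ≟ p | u ≟ q
      ... | yes u≡p | _       = inj₁ u≡p
      ... | no  _   | yes u≡q = inj₂ u≡q
      ... | no  u≢p | no  u≢q = ⊥-elim (none (u , Equivalence.from T-≡ v~u , u≢p , u≢q))
      at-most-two : degree G v ≤ 2
      at-most-two = Unique⇒length≤2 (Unique.filter⁺ adjacent? (Unique.allFin⁺ n))
                                    (All.map in-p-q (All.all-filter adjacent? (allFin n)))

    cycle-beyond-sole-boundary : ∀ {S b₀} → (∀ {b} → Boundary S b → b ≡ b₀) → Adj G b₀ x → x ∉ S →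
                                 ReachableCycle (_∉ b₀ ∷ S) b₀
    cycle-beyond-sole-boundary {x} {S} {b₀} sole b₀~x x∉S =
      step tt b₀~x (here tt) ◅ᶜ cycle-in-deg≥2 continue (∉-∷⁺ (Adj⇒≢ (Adj-sym b₀~x)) x∉S) (Adj-sym b₀~x)
      where
      continue : ∀ {u} → u ∉ b₀ ∷ S → ∀ p → ∃ λ u′ → Adj G u u′ × u′ ≢ p × u′ ∉ b₀ ∷ S
      continue {u} u∉ p with another-neighbour u p b₀
      ... | u′ , u~u′ , u′≢p , u′≢b₀ =
        u′ , u~u′ , u′≢p , ∉-∷⁺ u′≢b₀ λ u′∈S → u∉ (here (sole (u∉ ∘ there , lose u′∈S u~u′)))

    ear-or-cycle : ∀ {S} → Cycle (r ∷ L) → r ∉ S → ¬ Dominated S r → (∀ {b} → Boundary S b → b ∈ r ∷ L) →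
                   EarOf S r L ⊎ ReachableCycle (MeetsOnlyAt S (r ∷ L) r) r
    ear-or-cycle {r} {S = S} C r∉S ¬dom on-cycle with Cycle-ends C
    ... | a , M , c , refl with another-neighbour r a c
    -- x avoids both cycle neighbours a and c of r, so an edge r x into the cycle is a chord.
    ... | x , r~x , x≢a , x≢c with x ∈? r ∷ a ∷ M ∷ʳ c
    ...   | yes (here x≡r)  = ⊥-elim (Adj⇒≢ r~x (sym x≡r))
    ...   | yes (there x∈L) = inj₁ (chord-ear r~x x∈L x≢a x≢c)
    ...   | no  x∉C =
      [ arrival⇒ear-or-cycle r∉S , inj₂ ∘ (step tt r~x (here tt) ◅ᶜ_) ∘ meets-nothing ]′
        (nonbacktracking-walk continue (x∉S , x∉C) (Adj-sym r~x))
      where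
      C-vertices : List (Fin n)
      C-vertices = r ∷ a ∷ M ∷ʳ c
      x∉S : x ∉ S
      x∉S x∈S = ¬dom (lose x∈S r~x)
      continue : ∀ {u} → u ∉ S × u ∉ C-vertices → ∀ p →
                 ∃ λ u′ → Adj G u u′ × u′ ≢ p × (u′ ∈ C-vertices ⊎ u′ ∉ S × u′ ∉ C-vertices)
      continue {u} (u∉S , u∉C) p with another-neighbour u p p
      ... | u′ , u~u′ , u′≢p , _ with u′ ∈? C-vertices
      ...   | yes u′∈C = u′ , u~u′ , u′≢p , inj₁ u′∈C
      ...   | no  u′∉C =
        u′ , u~u′ , u′≢p , inj₂ ((λ u′∈S → u∉C (on-cycle (u∉S , lose u′∈S u~u′))) , u′∉C)
      meets-nothing : ReachableCycle (λ v → v ∉ S × v ∉ C-vertices) x →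
                      ReachableCycle (MeetsOnlyAt S C-vertices r) x
      meets-nothing cycle = ReachableCycle-map cycle λ _ (v∉S , v∉C) → v∉S , λ v∈C → ⊥-elim (v∉C v∈C)

    grow-at-undominated : ∀ {S b₁ b₂} → Cycle (r ∷ L) → All (_∉ S) (r ∷ L) → ¬ Dominated S r →
                          (∀ {b} → Boundary S b → b ∈ r ∷ L) → Boundary S b₁ → Boundary S b₂ → b₁ ≢ b₂ → Growth S
    grow-at-undominated {r} {L} {S} {b₁} {b₂} C outside ¬dom on-cycle bd₁ bd₂ b₁≢b₂ =
      from-ear-or-cycle (ear-or-cycle C (All.head outside) ¬dom on-cycle)
      where
      on-L : ∀ {b} → Boundary S b → b ∈ L
      on-L bd with on-cycle bd
      ... | here refl = ⊥-elim (¬dom (proj₂ bd))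
      ... | there b∈L = b∈L
      beyond : ∀ {b v} → Boundary S b → MeetsOnlyAt S (r ∷ L) r v → v ∉ b ∷ S
      beyond bd (v∉S , only-r) =
        ∉-∷⁺ (λ { refl → ¬dom (subst (Dominated S) (only-r (on-cycle bd)) (proj₂ bd)) }) v∉S
      from-ear-or-cycle : EarOf S r L ⊎ ReachableCycle (MeetsOnlyAt S (r ∷ L) r) r → Growth S
      from-ear-or-cycle (inj₂ cycle) =
        grow-by bd₁ (Cycle-walk C (on-cycle bd₁) (here refl) ◅ᶜ ReachableCycle-map cycle λ _ → beyond bd₁)
      from-ear-or-cycle (inj₁ E) with b₁ ≟ EarOf.foot E
      ... | yes b₁≡y =
        grow-by bd₂ (cycle-beyond-ear C outside E (on-L bd₂) λ b₂≡y → b₁≢b₂ (trans b₁≡y (sym b₂≡y)))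
      ... | no  b₁≢y = grow-by bd₁ (cycle-beyond-ear C outside E (on-L bd₁) b₁≢y)

    grow : ∀ {S s} → s ∈ S → (C : ReachableCycle (_∉ S) s) → r ∈ ReachableCycle.cycle C → ¬ Dominated S r →
           Growth S
    grow {r} {S} {s} s∈S C r∈K ¬dom =
      boundary-off-cycle (Fin.any? λ b → boundary? S b ×-dec ¬? (b ∈? cycle))
      where
      open ReachableCycle C
      boundary-off-cycle : Dec (∃ λ b → Boundary S b × b ∉ cycle) → Growth S
      boundary-off-cycle (yes (b , bd , b∉K)) = record
        { vertex = b ; boundary = bd ; source = s ; source∈ = there s∈S
        ; cycle = ReachableCycle-map C λ v∈K v∉S → ∉-∷⁺ (λ { refl → b∉K v∈K }) v∉S }
      boundary-off-cycle (no none) = another-boundary (Fin.any? λ b → boundary? S b ×-dec ¬? (b ≟ b₀))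
        where
        on-cycle : ∀ {b} → Boundary S b → b ∈ cycle
        on-cycle bd = decidable-stable (_ ∈? cycle) λ b∉K → none (_ , bd , b∉K)
        crossing : ∃ (Boundary S)
        crossing = walk-crosses-boundary s∈S (All.lookup inside target∈) walk
        b₀ = proj₁ crossing
        bd₀ = proj₂ crossing
        another-boundary : Dec (∃ λ b → Boundary S b × b ≢ b₀) → Growth S
        another-boundary (yes (b₁ , bd₁ , b₁≢b₀)) with Cycle-rotate isCycle r∈K
        ... | L , C′ , K↭ = grow-at-undominated C′ (All.anti-mono (⊆-reflexive-↭ (↭-sym K↭)) inside) ¬dom
                                                (∈-resp-↭ K↭ ∘ on-cycle) bd₁ bd₀ b₁≢b₀
        another-boundary (no sole) with Cycle-neighbour isCycle (on-cycle bd₀)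
        ... | x , x∈K , b₀~x = grow-by bd₀ (cycle-beyond-sole-boundary only-b₀ b₀~x (All.lookup inside x∈K))
          where
          only-b₀ : ∀ {b} → Boundary S b → b ≡ b₀
          only-b₀ bd = decidable-stable (_ ≟ b₀) λ b≢b₀ → sole (_ , bd , b≢b₀)

    dominating-model : ∀ {S s} → Acc _⊐_ S → NonEmptyConnected G ⟦ S ⟧ → s ∈ S → ReachableCycle (_∉ S) s →
                       DominatingModel G 4
    dominating-model {S} (acc smaller) S-connected s∈S C with All.all? (dominated? S) (ReachableCycle.cycle C)
    ... | yes dominated = cycle-model S-connected (ReachableCycle.isCycle C) (ReachableCycle.inside C) dominated
    ... | no  ¬dominated with find (All.¬All⇒Any¬ (dominated? S) _ ¬dominated)
    ...   | r , r∈K , ¬dom =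
      dominating-model (smaller (∷-⊐ (proj₁ boundary))) (NonEmptyConnected-∷ S-connected (proj₂ boundary))
                       source∈ cycle
      where open Growth (grow s∈S C r∈K ¬dom)

theorem7 : (n : ℕ) (G : Graph (suc n)) → minDegree≥ G 3 → DominatingModel G 4
theorem7 n G δ≥3 with another-neighbour G δ≥3 zero zero zero
-- The empty set has no boundary, so vertex 0 may serve as its sole boundary vertex.
... | x , 0~x , _ =
  dominating-model G δ≥3 (⊐-wellFounded [ zero ]) (Linked⇒NonEmptyConnected G [-]) (here refl)
    (cycle-beyond-sole-boundary G δ≥3 (λ { (_ , ()) }) 0~x λ ())
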